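{- Let $m,c$ be positive integers, let $T_n$ denote the number of $(c,m)$-colored $B_n$-partitions, and let $\xi_n$ be the number of non-zero-blocks of a uniformly random $(c,m)$-colored $B_n$-partition. Then the expectation $E_n$ and variance $V_n$ of $\xi_n$ satisfy \[ E_n=\frac{T_{n+1}}{mT_n}-\frac{1+c}{m},\qquad V_n=\frac{T_{n+2}}{m^2T_n}-\frac{T_{n+1}^2}{m^2T_n^2}-\frac1m . \]
   Context: Let $n,m,c$ be positive integers, and let $C_1$ be a list of $c$ colors and $C_2$ a list of $m$ colors. A $(c,m)$-colored $B_n$-partition is obtained as follows: take a set partition $\pi$ of $\{0,1,\dots,n\}$; the block containing $0$ is called the zero-block, all other blocks are non-zero-blocks. For $x\in\{0,\dots,n\}$ let $b_x$ be the block containing $x$. Each $x\in\{1,\dots,n\}$ is assigned a color: if $x=\min b_x$, it gets the first color of $C_2$; if $x\neq\min b_x$ and $x$ lies in the zero-block, it gets any color of $C_1$; if $x\ne \min b_x$ and $x$ is not in the zero-block, it gets any color of $C_2$. Two colored partitions are different if the underlying partitions differ or some element gets a different color. -}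

module Defs where

open import Data.Nat using (ℕ; zero; suc; _+_; _*_; _⊔_)
open import Data.Nat.Base using (NonZero)
open import Data.Integer using (+_)
open import Data.List using (List; []; _∷_; _++_; [_]; map; concatMap; length; upTo; foldr)
open import Data.Nat.ListAction using (sum)
open import Data.Product using (_×_; _,_)
open import Data.Rational using (ℚ; 0ℚ; _/_; _-_) renaming (_*_ to _*ℚ_)

-- A coloured element x ∈ {1,…,n}: the label of its block in the
-- restricted-growth-string (canonical) encoding of the set partition of
-- {0,…,n}, and the index of its colour.
--   * label 0  = the zero-block (the block containing 0; 0 itself has label 0)
--   * labels 1,2,… = non-zero-blocks, numbered in order of their minima
--   * colour index i refers to the i-th colour of C₁ if x is in the
--     zero-block and x ≠ min b_x, and to the i-th colour of C₂ otherwise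
--     (for x = min b_x the colour index is always 0, the first colour of C₂).
record Elem : Set where
  constructor elem
  field
    blk : ℕ
    col : ℕ

-- Possible data for the next element x, given that elements 0,…,x-1 form
-- k non-zero-blocks (labels 1..k):
--   * x opens a new non-zero-block (x = min b_x): label suc k, first colour of C₂
--   * x joins the zero-block (x ≠ min b_x): any of the c colours of C₁
--   * x joins non-zero-block j ∈ {1..k} (x ≠ min b_x): any of the m colours of C₂
choices : (c m k : ℕ) → List Elem
choices c m k =
  elem (suc k) 0
  ∷ (map (elem 0) (upTo c)
  ++ concatMap (λ j → map (elem (suc j)) (upTo m)) (upTo k))

-- All (c,m)-coloured B_n-partitions, each paired with its number of
-- non-zero-blocks; a partition is the list of data of the elements 1,…,n.
colouredB : (c m n : ℕ) → List (ℕ × List Elem)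
colouredB c m zero = (0 , []) ∷ []
colouredB c m (suc n) =
  concatMap (λ { (k , xs) → map (λ e → (k ⊔ Elem.blk e , xs ++ [ e ])) (choices c m k) })
            (colouredB c m n)

nonZeroBlocks : List Elem → ℕ
nonZeroBlocks = foldr (λ e r → Elem.blk e ⊔ r) 0

partitions : (c m n : ℕ) → List (List Elem)
partitions c m n = map (λ { (_ , xs) → xs }) (colouredB c m n)

T : (c m n : ℕ) → ℕ
T c m n = length (partitions c m n)

sumξ : (c m n : ℕ) → ℕ
sumξ c m n = sum (map nonZeroBlocks (partitions c m n))

sumξ² : (c m n : ℕ) → ℕ
sumξ² c m n = sum (map (λ p → nonZeroBlocks p * nonZeroBlocks p) (partitions c m n))

-- a / b as a rational (totalised: a / 0 := 0; never used with b = 0 below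
-- since c, m ≥ 1 imply T_n ≥ 1).
_÷ℕ_ : ℕ → ℕ → ℚ
a ÷ℕ zero = 0ℚ
a ÷ℕ suc b = (+ a) / suc b

E : (c m n : ℕ) → ℚ
E c m n = sumξ c m n ÷ℕ T c m n

V : (c m n : ℕ) → ℚ
V c m n = (sumξ² c m n ÷ℕ T c m n) - (E c m n *ℚ E c m n)

module Submission where

-- Element n+1 can be added to a coloured B_n-partition with k non-zero-blocks in 1 + c + k·m
-- ways: it opens block k+1, or joins the zero-block (c colours) or one of the k other blocks
-- (m colours each), leaving k unchanged.  Hence, for every f : ℕ → ℕ,
--   Σ_{B_{n+1}} f(ξ) = Σ_{B_n} (f(ξ+1) + c·f(ξ) + m·ξ·f(ξ)),
-- and f = 1, f = ξ give  T_{n+1} = (1+c)·T_n + m·Σ_{B_n} ξ  and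
--   Σ_{B_{n+1}} ξ = T_n + (1+c)·Σ_{B_n} ξ + m·Σ_{B_n} ξ².
-- Divided by T_n, these express T_{n+1}/T_n and T_{n+2}/T_n as polynomials in c, m, E_n and
-- Σ_{B_n} ξ²/T_n, and both formulas follow by elimination.

open import Defs

module Recurrences where
  open import Data.Nat using (ℕ; zero; suc; _+_; _*_; _≤_; _<_; _⊔_; z≤n; s≤s)
  open import Data.Nat.Properties
  open import Data.Nat.Tactic.RingSolver using (solve-∀)
  open import Data.Nat.ListAction using (sum)
  open import Data.Nat.ListAction.Properties using (sum-++)
  open import Data.List using (List; []; _∷_; _++_; [_]; map; concatMap; length; upTo)
  open import Data.List.Properties
    using (map-++; map-∘; map-cong; map-cong-local; length-++; length-map; length-upTo)
  open import Data.List.Relation.Unary.All as All using (All; []; _∷_)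
  open import Data.List.Relation.Unary.All.Properties using (++⁺; map⁺; concat⁺; applyUpTo⁺₁)
  open import Data.Product using (_×_; _,_; proj₁; proj₂)
  open import Function using (_∘_; id; const)
  open import Relation.Binary.PropositionalEquality
    using (_≡_; refl; sym; trans; cong; cong₂; module ≡-Reasoning)
  open import Algebra.Properties.CommutativeSemigroup +-commutativeSemigroup using (interchange)

  private variable
    A B : Set

  sum-map-+ : ∀ (f g : A → ℕ) xs →
    sum (map (λ x → f x + g x) xs) ≡ sum (map f xs) + sum (map g xs)
  sum-map-+ f g []       = refl
  sum-map-+ f g (x ∷ xs) =
    trans (cong (f x + g x +_) (sum-map-+ f g xs)) (interchange (f x) (g x) _ _)

  sum-map-*ˡ : ∀ n (f : A → ℕ) xs → sum (map (λ x → n * f x) xs) ≡ n * sum (map f xs)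
  sum-map-*ˡ n f []       = sym (*-zeroʳ n)
  sum-map-*ˡ n f (x ∷ xs) =
    trans (cong (n * f x +_) (sum-map-*ˡ n f xs)) (sym (*-distribˡ-+ n (f x) _))

  sum-map-const : ∀ n (xs : List A) → sum (map (const n) xs) ≡ length xs * n
  sum-map-const n []       = refl
  sum-map-const n (x ∷ xs) = cong (n +_) (sum-map-const n xs)

  sum-map-concatMap : ∀ (f : B → ℕ) (g : A → List B) xs →
    sum (map f (concatMap g xs)) ≡ sum (map (sum ∘ map f ∘ g) xs)
  sum-map-concatMap f g []       = refl
  sum-map-concatMap f g (x ∷ xs) = begin
    sum (map f (g x ++ concatMap g xs))                ≡⟨ cong sum (map-++ f (g x) _) ⟩
    sum (map f (g x) ++ map f (concatMap g xs))        ≡⟨ sum-++ (map f (g x)) _ ⟩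
    sum (map f (g x)) + sum (map f (concatMap g xs))   ≡⟨ cong (_ +_) (sum-map-concatMap f g xs) ⟩
    sum (map f (g x)) + sum (map (sum ∘ map f ∘ g) xs) ∎
    where open ≡-Reasoning

  length-concatMap : ∀ (g : A → List B) xs → length (concatMap g xs) ≡ sum (map (length ∘ g) xs)
  length-concatMap g []       = refl
  length-concatMap g (x ∷ xs) =
    trans (length-++ (g x)) (cong (length (g x) +_) (length-concatMap g xs))

  nonZeroBlocks-++ : ∀ xs ys → nonZeroBlocks (xs ++ ys) ≡ nonZeroBlocks xs ⊔ nonZeroBlocks ys
  nonZeroBlocks-++ []       ys = refl
  nonZeroBlocks-++ (x ∷ xs) ys =
    trans (cong (Elem.blk x ⊔_) (nonZeroBlocks-++ xs ys)) (sym (⊔-assoc (Elem.blk x) _ _))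

  nonZeroBlocks-∷ʳ : ∀ xs e → nonZeroBlocks (xs ++ [ e ]) ≡ nonZeroBlocks xs ⊔ Elem.blk e
  nonZeroBlocks-∷ʳ xs e =
    trans (nonZeroBlocks-++ xs [ e ]) (cong (nonZeroBlocks xs ⊔_) (⊔-identityʳ (Elem.blk e)))

  colouredB-nonZeroBlocks : ∀ c m n →
    All (λ p → nonZeroBlocks (proj₂ p) ≡ proj₁ p) (colouredB c m n)
  colouredB-nonZeroBlocks c m zero    = refl ∷ []
  colouredB-nonZeroBlocks c m (suc n) =
    concat⁺ (map⁺ (All.map extend (colouredB-nonZeroBlocks c m n)))
    where
    extend : ∀ {k xs} → nonZeroBlocks xs ≡ k →
      All (λ q → nonZeroBlocks (proj₂ q) ≡ proj₁ q)
          (map (λ e → (k ⊔ Elem.blk e , xs ++ [ e ])) (choices c m k))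
    extend {xs = xs} eq =
      map⁺ (All.universal (λ e → trans (nonZeroBlocks-∷ʳ xs e) (cong (_⊔ Elem.blk e) eq)) _)

  joinChoices : (c m k : ℕ) → List Elem
  joinChoices c m k =
    map (elem 0) (upTo c) ++ concatMap (λ j → map (elem (suc j)) (upTo m)) (upTo k)

  joinChoices-blk≤ : ∀ c m k → All (λ e → Elem.blk e ≤ k) (joinChoices c m k)
  joinChoices-blk≤ c m k = ++⁺ (map⁺ (All.universal (λ _ → z≤n) (upTo c)))
    (concat⁺ (map⁺ (applyUpTo⁺₁ id k (λ j<k → map⁺ (All.universal (λ _ → j<k) (upTo m))))))

  length-joinChoices : ∀ c m k → length (joinChoices c m k) ≡ c + k * m
  length-joinChoices c m k = begin
    length (map (elem 0) (upTo c) ++ concatMap g (upTo k))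
      ≡⟨ length-++ (map (elem 0) (upTo c)) ⟩
    length (map (elem 0) (upTo c)) + length (concatMap g (upTo k))
      ≡⟨ cong₂ _+_ (trans (length-map (elem 0) (upTo c)) (length-upTo c))
                   (length-concatMap g (upTo k)) ⟩
    c + sum (map (length ∘ g) (upTo k))
      ≡⟨ cong (λ ls → c + sum ls) (map-cong length-g (upTo k)) ⟩
    c + sum (map (const m) (upTo k))
      ≡⟨ cong (c +_) (trans (sum-map-const m (upTo k)) (cong (_* m) (length-upTo k))) ⟩
    c + k * m ∎
    where
    open ≡-Reasoning
    g : ℕ → List Elem
    g j = map (elem (suc j)) (upTo m)
    length-g : ∀ j → length (g j) ≡ m
    length-g j = trans (length-map (elem (suc j)) (upTo m)) (length-upTo m)

  sum-choices : ∀ c m k (f : ℕ → ℕ) →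
    sum (map (λ e → f (k ⊔ Elem.blk e)) (choices c m k)) ≡ f (suc k) + (c + k * m) * f k
  sum-choices c m k f = cong₂ _+_ (cong f (m≤n⇒m⊔n≡n (n≤1+n k))) (begin
    sum (map (λ e → f (k ⊔ Elem.blk e)) (joinChoices c m k))
      ≡⟨ cong sum (map-cong-local (All.map (cong f ∘ m≥n⇒m⊔n≡m) (joinChoices-blk≤ c m k))) ⟩
    sum (map (const (f k)) (joinChoices c m k)) ≡⟨ sum-map-const (f k) (joinChoices c m k) ⟩
    length (joinChoices c m k) * f k            ≡⟨ cong (_* f k) (length-joinChoices c m k) ⟩
    (c + k * m) * f k                           ∎)
    where open ≡-Reasoning

  moment : (c m n : ℕ) → (ℕ → ℕ) → ℕ
  moment c m n f = sum (map (f ∘ proj₁) (colouredB c m n))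

  moment-+ : ∀ c m n (f g : ℕ → ℕ) →
    moment c m n (λ k → f k + g k) ≡ moment c m n f + moment c m n g
  moment-+ c m n f g = sum-map-+ (f ∘ proj₁) (g ∘ proj₁) (colouredB c m n)

  moment-*ˡ : ∀ c m n a (f : ℕ → ℕ) → moment c m n (λ k → a * f k) ≡ a * moment c m n f
  moment-*ˡ c m n a f = sum-map-*ˡ a (f ∘ proj₁) (colouredB c m n)

  moment-cong : ∀ c m n {f g : ℕ → ℕ} → (∀ k → f k ≡ g k) → moment c m n f ≡ moment c m n g
  moment-cong c m n f≗g = cong sum (map-cong (f≗g ∘ proj₁) (colouredB c m n))

  moment-suc : ∀ c m n (f : ℕ → ℕ) →
    moment c m (suc n) f
      ≡ moment c m n (f ∘ suc) + c * moment c m n f + m * moment c m n (λ k → k * f k)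
  moment-suc c m n f = begin
    moment c m (suc n) f
      ≡⟨ sum-map-concatMap (f ∘ proj₁) _ (colouredB c m n) ⟩
    sum (map (λ p → sum (map (f ∘ proj₁) (extend (proj₁ p) (proj₂ p)))) (colouredB c m n))
      ≡⟨ cong sum (map-cong (λ p → sum-extend (proj₁ p) (proj₂ p)) (colouredB c m n)) ⟩
    moment c m n (λ k → f (suc k) + c * f k + m * (k * f k))
      ≡⟨ trans (moment-+ c m n _ _) (cong₂ _+_ (moment-+ c m n _ _) (moment-*ˡ c m n m _)) ⟩
    moment c m n (f ∘ suc) + moment c m n (λ k → c * f k) + m * moment c m n (λ k → k * f k)
      ≡⟨ cong (λ s → moment c m n (f ∘ suc) + s + m * moment c m n (λ k → k * f k))
               (moment-*ˡ c m n c f) ⟩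
    moment c m n (f ∘ suc) + c * moment c m n f + m * moment c m n (λ k → k * f k) ∎
    where
    open ≡-Reasoning
    extend : ℕ → List Elem → List (ℕ × List Elem)
    extend k xs = map (λ e → (k ⊔ Elem.blk e , xs ++ [ e ])) (choices c m k)
    distribute : ∀ c m k a → (c + k * m) * a ≡ c * a + m * (k * a)
    distribute = solve-∀
    sum-extend : ∀ k xs →
      sum (map (f ∘ proj₁) (extend k xs)) ≡ f (suc k) + c * f k + m * (k * f k)
    sum-extend k xs = begin
      sum (map (f ∘ proj₁) (extend k xs))                  ≡⟨ cong sum (map-∘ (choices c m k)) ⟨
      sum (map (λ e → f (k ⊔ Elem.blk e)) (choices c m k)) ≡⟨ sum-choices c m k f ⟩
      f (suc k) + (c + k * m) * f k                        ≡⟨ cong (f (suc k) +_) (distribute c m k (f k)) ⟩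
      f (suc k) + (c * f k + m * (k * f k))                ≡⟨ +-assoc (f (suc k)) _ _ ⟨
      f (suc k) + c * f k + m * (k * f k)                  ∎

  sum-map-nonZeroBlocks : ∀ c m n (f : ℕ → ℕ) →
    sum (map (f ∘ nonZeroBlocks) (partitions c m n)) ≡ moment c m n f
  sum-map-nonZeroBlocks c m n f = cong sum (begin
    map (f ∘ nonZeroBlocks) (map proj₂ (colouredB c m n))
      ≡⟨ map-∘ (colouredB c m n) ⟨
    map (f ∘ nonZeroBlocks ∘ proj₂) (colouredB c m n)
      ≡⟨ map-cong-local (All.map (cong f) (colouredB-nonZeroBlocks c m n)) ⟩
    map (f ∘ proj₁) (colouredB c m n) ∎)
    where open ≡-Reasoning

  T≡moment : ∀ c m n → T c m n ≡ moment c m n (const 1)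
  T≡moment c m n = begin
    length (partitions c m n)              ≡⟨ *-identityʳ _ ⟨
    length (partitions c m n) * 1          ≡⟨ sum-map-const 1 (partitions c m n) ⟨
    sum (map (const 1) (partitions c m n)) ≡⟨ sum-map-nonZeroBlocks c m n (const 1) ⟩
    moment c m n (const 1)                 ∎
    where open ≡-Reasoning

  T-suc : ∀ c m n → T c m (suc n) ≡ T c m n + c * T c m n + m * sumξ c m n
  T-suc c m n = begin
    T c m (suc n)                ≡⟨ T≡moment c m (suc n) ⟩
    moment c m (suc n) (const 1) ≡⟨ moment-suc c m n (const 1) ⟩
    moment c m n (const 1) + c * moment c m n (const 1) + m * moment c m n (λ k → k * 1)
      ≡⟨ cong (λ s → moment c m n (const 1) + c * moment c m n (const 1) + m * s)
               (moment-cong c m n *-identityʳ) ⟩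
    moment c m n (const 1) + c * moment c m n (const 1) + m * moment c m n id
      ≡⟨ cong₂ (λ t s → t + c * t + m * s) (T≡moment c m n) (sum-map-nonZeroBlocks c m n id) ⟨
    T c m n + c * T c m n + m * sumξ c m n ∎
    where open ≡-Reasoning

  sumξ-suc : ∀ c m n →
    sumξ c m (suc n) ≡ T c m n + sumξ c m n + c * sumξ c m n + m * sumξ² c m n
  sumξ-suc c m n = begin
    sumξ c m (suc n)      ≡⟨ sum-map-nonZeroBlocks c m (suc n) id ⟩
    moment c m (suc n) id ≡⟨ moment-suc c m n id ⟩
    moment c m n suc + c * moment c m n id + m * moment c m n (λ k → k * k)
      ≡⟨ cong (λ s → s + c * moment c m n id + m * moment c m n (λ k → k * k))
               (moment-+ c m n (const 1) id) ⟩
    moment c m n (const 1) + moment c m n id + c * moment c m n id + m * moment c m n (λ k → k * k)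
      ≡⟨ cong₂ (λ t s → t + s + c * s + m * moment c m n (λ k → k * k))
                (T≡moment c m n) (sum-map-nonZeroBlocks c m n id) ⟨
    T c m n + sumξ c m n + c * sumξ c m n + m * moment c m n (λ k → k * k)
      ≡⟨ cong (λ s² → T c m n + sumξ c m n + c * sumξ c m n + m * s²)
               (sum-map-nonZeroBlocks c m n (λ k → k * k)) ⟨
    T c m n + sumξ c m n + c * sumξ c m n + m * sumξ² c m n ∎
    where open ≡-Reasoning

  T-positive : ∀ c m n → 0 < T c m n
  T-positive c m zero    = s≤s z≤n
  T-positive c m (suc n) = begin-strict
    0                                      <⟨ T-positive c m n ⟩
    T c m n                                ≤⟨ m≤m+n (T c m n) (c * T c m n) ⟩
    T c m n + c * T c m n                  ≤⟨ m≤m+n (T c m n + c * T c m n) (m * sumξ c m n) ⟩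
    T c m n + c * T c m n + m * sumξ c m n ≡⟨ T-suc c m n ⟨
    T c m (suc n)                          ∎
    where open ≤-Reasoning

module MeanVariance where
  open import Level using (0ℓ)
  open import Data.Nat as ℕ using (ℕ; suc; NonZero)
  import Data.Nat.Properties as ℕ
  open import Data.Integer as ℤ using (+_)
  import Data.Integer.Properties as ℤ
  open import Data.List using (_∷_; [])
  open import Data.Rational using (ℚ; 0ℚ; 1ℚ; _+_; _*_; _-_; toℚᵘ)
  open import Data.Rational.Properties
    using (+-*-commutativeRing; _≟_; toℚᵘ-injective; toℚᵘ-fromℚᵘ; toℚᵘ-homo-+; toℚᵘ-homo-*;
           *-identityˡ; *-identityʳ; *-distribʳ-+)
  open import Data.Rational.Unnormalised as ℚᵘ using (mkℚᵘ; *≡*)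
  import Data.Rational.Unnormalised.Properties as ℚᵘ
  open import Relation.Nullary.Decidable using (dec⇒maybe)
  open import Relation.Binary.PropositionalEquality
    using (_≡_; refl; sym; trans; cong; cong₂; module ≡-Reasoning)
  open import Tactic.RingSolver using (solve)
  open import Tactic.RingSolver.Core.AlmostCommutativeRing
    using (AlmostCommutativeRing; fromCommutativeRing)

  fromℕ : ℕ → ℚ
  fromℕ n = n ÷ℕ 1

  -- a ÷ℕ suc d is fromℚᵘ (mkℚᵘ (+ a) d), so identities between such fractions reduce, via
  -- toℚᵘ-injective, to cross-multiplication in ℚᵘ.
  ÷ℕ-* : ∀ a b c d .{{_ : NonZero c}} .{{_ : NonZero d}} →
    (a ℕ.* b) ÷ℕ (c ℕ.* d) ≡ a ÷ℕ c * b ÷ℕ d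
  ÷ℕ-* a b (suc c) (suc d) = toℚᵘ-injective (begin
    toℚᵘ ((a ℕ.* b) ÷ℕ (suc c ℕ.* suc d))   ≈⟨ toℚᵘ-fromℚᵘ (mkℚᵘ (+ (a ℕ.* b)) _) ⟩
    mkℚᵘ (+ (a ℕ.* b)) (d ℕ.+ c ℕ.* suc d)   ≈⟨ *≡* (cong (ℤ._* + (suc c ℕ.* suc d)) (ℤ.pos-* a b)) ⟩
    mkℚᵘ (+ a) c ℚᵘ.* mkℚᵘ (+ b) d           ≈⟨ ℚᵘ.*-cong (toℚᵘ-fromℚᵘ (mkℚᵘ (+ a) c))
                                                           (toℚᵘ-fromℚᵘ (mkℚᵘ (+ b) d)) ⟨
    toℚᵘ (a ÷ℕ suc c) ℚᵘ.* toℚᵘ (b ÷ℕ suc d) ≈⟨ toℚᵘ-homo-* (a ÷ℕ suc c) (b ÷ℕ suc d) ⟨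
    toℚᵘ (a ÷ℕ suc c * b ÷ℕ suc d)           ∎)
    where open ℚᵘ.≃-Reasoning

  fromℕ-+ : ∀ a b → fromℕ (a ℕ.+ b) ≡ fromℕ a + fromℕ b
  fromℕ-+ a b = toℚᵘ-injective (begin
    toℚᵘ (fromℕ (a ℕ.+ b))             ≈⟨ toℚᵘ-fromℚᵘ (mkℚᵘ (+ (a ℕ.+ b)) 0) ⟩
    mkℚᵘ (+ (a ℕ.+ b)) 0                ≈⟨ *≡* (cong (ℤ._* + 1) pos-+) ⟩
    mkℚᵘ (+ a) 0 ℚᵘ.+ mkℚᵘ (+ b) 0      ≈⟨ ℚᵘ.+-cong (toℚᵘ-fromℚᵘ (mkℚᵘ (+ a) 0))
                                                     (toℚᵘ-fromℚᵘ (mkℚᵘ (+ b) 0)) ⟨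
    toℚᵘ (fromℕ a) ℚᵘ.+ toℚᵘ (fromℕ b)  ≈⟨ toℚᵘ-homo-+ (fromℕ a) (fromℕ b) ⟨
    toℚᵘ (fromℕ a + fromℕ b)            ∎)
    where
    open ℚᵘ.≃-Reasoning
    pos-+ : + (a ℕ.+ b) ≡ + a ℤ.* + 1 ℤ.+ + b ℤ.* + 1
    pos-+ = trans (ℤ.pos-+ a b) (sym (cong₂ ℤ._+_ (ℤ.*-identityʳ (+ a)) (ℤ.*-identityʳ (+ b))))

  n÷ℕn≡1 : ∀ n .{{_ : NonZero n}} → n ÷ℕ n ≡ 1ℚ
  n÷ℕn≡1 (suc n) = toℚᵘ-injective
    (ℚᵘ.≃-trans (toℚᵘ-fromℚᵘ (mkℚᵘ (+ suc n) n)) (*≡* (ℤ.*-comm (+ suc n) (+ 1))))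

  ÷ℕ-*ˡ : ∀ a b d .{{_ : NonZero d}} → (a ℕ.* b) ÷ℕ d ≡ fromℕ a * b ÷ℕ d
  ÷ℕ-*ˡ a b d = trans (cong ((a ℕ.* b) ÷ℕ_) (sym (ℕ.*-identityˡ d))) (÷ℕ-* a b 1 d)

  ÷ℕ-*-denominator : ∀ a c d .{{_ : NonZero c}} .{{_ : NonZero d}} →
    a ÷ℕ (c ℕ.* d) ≡ 1 ÷ℕ c * a ÷ℕ d
  ÷ℕ-*-denominator a c d = trans (cong (_÷ℕ (c ℕ.* d)) (sym (ℕ.*-identityˡ a))) (÷ℕ-* 1 a c d)

  ÷ℕ≡fromℕ*1÷ℕ : ∀ a d .{{_ : NonZero d}} → a ÷ℕ d ≡ fromℕ a * 1 ÷ℕ d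
  ÷ℕ≡fromℕ*1÷ℕ a d = trans (cong (_÷ℕ d) (sym (ℕ.*-identityʳ a))) (÷ℕ-*ˡ a 1 d)

  fromℕ*1÷ℕ≡1 : ∀ n .{{_ : NonZero n}} → fromℕ n * 1 ÷ℕ n ≡ 1ℚ
  fromℕ*1÷ℕ≡1 n = trans (sym (÷ℕ≡fromℕ*1÷ℕ n n)) (n÷ℕn≡1 n)

  ÷ℕ-+ : ∀ a b d .{{_ : NonZero d}} → (a ℕ.+ b) ÷ℕ d ≡ a ÷ℕ d + b ÷ℕ d
  ÷ℕ-+ a b d = begin
    (a ℕ.+ b) ÷ℕ d                      ≡⟨ ÷ℕ≡fromℕ*1÷ℕ (a ℕ.+ b) d ⟩
    fromℕ (a ℕ.+ b) * 1 ÷ℕ d            ≡⟨ cong (_* 1 ÷ℕ d) (fromℕ-+ a b) ⟩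
    (fromℕ a + fromℕ b) * 1 ÷ℕ d        ≡⟨ *-distribʳ-+ (1 ÷ℕ d) (fromℕ a) (fromℕ b) ⟩
    fromℕ a * 1 ÷ℕ d + fromℕ b * 1 ÷ℕ d ≡⟨ cong₂ _+_ (÷ℕ≡fromℕ*1÷ℕ a d) (÷ℕ≡fromℕ*1÷ℕ b d) ⟨
    a ÷ℕ d + b ÷ℕ d                     ∎
    where open ≡-Reasoning

  ÷ℕ-affine : ∀ a b c d e f .{{_ : NonZero f}} →
    (a ℕ.+ b ℕ.* c ℕ.+ d ℕ.* e) ÷ℕ f ≡ a ÷ℕ f + fromℕ b * c ÷ℕ f + fromℕ d * e ÷ℕ f
  ÷ℕ-affine a b c d e f = trans (÷ℕ-+ (a ℕ.+ b ℕ.* c) (d ℕ.* e) f)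
    (cong₂ _+_ (trans (÷ℕ-+ a (b ℕ.* c) f) (cong (_+_ (a ÷ℕ f)) (÷ℕ-*ˡ b c f))) (÷ℕ-*ˡ d e f))

  ℚ-ring : AlmostCommutativeRing 0ℓ 0ℓ
  ℚ-ring = fromCommutativeRing +-*-commutativeRing (λ x → dec⇒maybe (0ℚ ≟ x))

  mean-identity : ∀ (c m x v : ℚ) → m * v ≡ 1ℚ → v * (1ℚ + c + m * x) - (1ℚ + c) * v ≡ x
  mean-identity c m x v mv≡1 = begin
    v * (1ℚ + c + m * x) - (1ℚ + c) * v ≡⟨ solve (c ∷ m ∷ x ∷ v ∷ []) ℚ-ring ⟩
    m * v * x                           ≡⟨ cong (_* x) mv≡1 ⟩
    1ℚ * x                              ≡⟨ *-identityˡ x ⟩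
    x                                   ∎
    where open ≡-Reasoning

  variance-identity : ∀ (c m x y v : ℚ) → m * v ≡ 1ℚ →
    let r₁ = 1ℚ + c + m * x in
    v * v * (r₁ + c * r₁ + m * (1ℚ + x + c * x + m * y)) - v * v * (r₁ * r₁) - v ≡ y - x * x
  variance-identity c m x y v mv≡1 = let r₁ = 1ℚ + c + m * x in begin
    v * v * (r₁ + c * r₁ + m * (1ℚ + x + c * x + m * y)) - v * v * (r₁ * r₁) - v
      ≡⟨ solve (c ∷ m ∷ x ∷ y ∷ v ∷ []) ℚ-ring ⟩
    m * v * v + m * v * (m * v) * (y - x * x) - v
      ≡⟨ cong (λ mv → mv * v + mv * mv * (y - x * x) - v) mv≡1 ⟩
    1ℚ * v + 1ℚ * 1ℚ * (y - x * x) - v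
      ≡⟨ solve (x ∷ y ∷ v ∷ []) ℚ-ring ⟩
    y - x * x ∎
    where open ≡-Reasoning

  module _ (c m t : ℕ) .{{_ : NonZero m}} .{{_ : NonZero t}} where

    normalise-count-recurrence : ∀ {s₁ t₁} → t₁ ≡ t ℕ.+ c ℕ.* t ℕ.+ m ℕ.* s₁ →
      t₁ ÷ℕ t ≡ 1ℚ + fromℕ c + fromℕ m * s₁ ÷ℕ t
    normalise-count-recurrence {s₁} refl = begin
      (t ℕ.+ c ℕ.* t ℕ.+ m ℕ.* s₁) ÷ℕ t
        ≡⟨ ÷ℕ-affine t c t m s₁ t ⟩
      t ÷ℕ t + fromℕ c * t ÷ℕ t + fromℕ m * s₁ ÷ℕ t
        ≡⟨ cong (λ one → one + fromℕ c * one + fromℕ m * s₁ ÷ℕ t) (n÷ℕn≡1 t) ⟩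
      1ℚ + fromℕ c * 1ℚ + fromℕ m * s₁ ÷ℕ t
        ≡⟨ cong (λ c′ → 1ℚ + c′ + fromℕ m * s₁ ÷ℕ t) (*-identityʳ (fromℕ c)) ⟩
      1ℚ + fromℕ c + fromℕ m * s₁ ÷ℕ t ∎
      where open ≡-Reasoning

    normalise-sum-recurrence : ∀ {s₁ s₂ s₁′} → s₁′ ≡ t ℕ.+ s₁ ℕ.+ c ℕ.* s₁ ℕ.+ m ℕ.* s₂ →
      s₁′ ÷ℕ t ≡ 1ℚ + s₁ ÷ℕ t + fromℕ c * s₁ ÷ℕ t + fromℕ m * s₂ ÷ℕ t
    normalise-sum-recurrence {s₁} {s₂} refl = begin
      (t ℕ.+ s₁ ℕ.+ c ℕ.* s₁ ℕ.+ m ℕ.* s₂) ÷ℕ t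
        ≡⟨ ÷ℕ-affine (t ℕ.+ s₁) c s₁ m s₂ t ⟩
      (t ℕ.+ s₁) ÷ℕ t + fromℕ c * s₁ ÷ℕ t + fromℕ m * s₂ ÷ℕ t
        ≡⟨ cong (λ r → r + fromℕ c * s₁ ÷ℕ t + fromℕ m * s₂ ÷ℕ t)
               (trans (÷ℕ-+ t s₁ t) (cong (_+ s₁ ÷ℕ t) (n÷ℕn≡1 t))) ⟩
      1ℚ + s₁ ÷ℕ t + fromℕ c * s₁ ÷ℕ t + fromℕ m * s₂ ÷ℕ t ∎
      where open ≡-Reasoning

    mean-from-recurrence : ∀ {s₁ t₁} → t₁ ≡ t ℕ.+ c ℕ.* t ℕ.+ m ℕ.* s₁ →
      s₁ ÷ℕ t ≡ t₁ ÷ℕ (m ℕ.* t) - (1 ℕ.+ c) ÷ℕ m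
    mean-from-recurrence {s₁} {t₁} t₁≡ = sym (begin
      t₁ ÷ℕ (m ℕ.* t) - (1 ℕ.+ c) ÷ℕ m
        ≡⟨ cong₂ _-_ (÷ℕ-*-denominator t₁ m t) (÷ℕ≡fromℕ*1÷ℕ (1 ℕ.+ c) m) ⟩
      1 ÷ℕ m * t₁ ÷ℕ t - fromℕ (1 ℕ.+ c) * 1 ÷ℕ m
        ≡⟨ cong₂ (λ r c′ → 1 ÷ℕ m * r - c′ * 1 ÷ℕ m)
                 (normalise-count-recurrence t₁≡) (fromℕ-+ 1 c) ⟩
      1 ÷ℕ m * (1ℚ + fromℕ c + fromℕ m * s₁ ÷ℕ t) - (1ℚ + fromℕ c) * 1 ÷ℕ m
        ≡⟨ mean-identity (fromℕ c) (fromℕ m) (s₁ ÷ℕ t) (1 ÷ℕ m) (fromℕ*1÷ℕ≡1 m) ⟩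
      s₁ ÷ℕ t ∎)
      where open ≡-Reasoning

    variance-from-recurrence : ∀ {s₁ s₂ t₁ s₁′ t₂} →
      t₁ ≡ t ℕ.+ c ℕ.* t ℕ.+ m ℕ.* s₁ →
      s₁′ ≡ t ℕ.+ s₁ ℕ.+ c ℕ.* s₁ ℕ.+ m ℕ.* s₂ →
      t₂ ≡ t₁ ℕ.+ c ℕ.* t₁ ℕ.+ m ℕ.* s₁′ →
      s₂ ÷ℕ t - s₁ ÷ℕ t * s₁ ÷ℕ t
        ≡ t₂ ÷ℕ (m ℕ.* m ℕ.* t) - (t₁ ℕ.* t₁) ÷ℕ (m ℕ.* m ℕ.* (t ℕ.* t)) - 1 ÷ℕ m
    variance-from-recurrence {s₁} {s₂} {t₁} {s₁′} {t₂} t₁≡ s₁′≡ t₂≡ = sym (begin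
      t₂ ÷ℕ (m ℕ.* m ℕ.* t) - (t₁ ℕ.* t₁) ÷ℕ (m ℕ.* m ℕ.* (t ℕ.* t)) - v
        ≡⟨ cong₂ (λ p q → p - q - v) (÷ℕ-*-denominator t₂ (m ℕ.* m) t)
                                     (÷ℕ-*-denominator (t₁ ℕ.* t₁) (m ℕ.* m) (t ℕ.* t)) ⟩
      1 ÷ℕ (m ℕ.* m) * t₂ ÷ℕ t - 1 ÷ℕ (m ℕ.* m) * (t₁ ℕ.* t₁) ÷ℕ (t ℕ.* t) - v
        ≡⟨ cong₂ (λ w p → w * t₂ ÷ℕ t - w * p - v) (÷ℕ-* 1 1 m m) (÷ℕ-* t₁ t₁ t t) ⟩
      v * v * t₂ ÷ℕ t - v * v * (r₁ * r₁) - v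
        ≡⟨ cong (λ r → v * v * r - v * v * (r₁ * r₁) - v)
               (trans (cong (_÷ℕ t) t₂≡) (÷ℕ-affine t₁ c t₁ m s₁′ t)) ⟩
      v * v * (r₁ + C * r₁ + M * s₁′ ÷ℕ t) - v * v * (r₁ * r₁) - v
        ≡⟨ cong₂ (λ r s → v * v * (r + C * r + M * s) - v * v * (r * r) - v)
                 (normalise-count-recurrence t₁≡) (normalise-sum-recurrence s₁′≡) ⟩
      v * v * (ρ₁ + C * ρ₁ + M * (1ℚ + x + C * x + M * y)) - v * v * (ρ₁ * ρ₁) - v
        ≡⟨ variance-identity C M x y v (fromℕ*1÷ℕ≡1 m) ⟩
      y - x * x ∎)
      where
      open ≡-Reasoning
      instance
        m*m≢0 : NonZero (m ℕ.* m)
        m*m≢0 = ℕ.m*n≢0 m m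
        t*t≢0 : NonZero (t ℕ.* t)
        t*t≢0 = ℕ.m*n≢0 t t
      C M v x y r₁ ρ₁ : ℚ
      C  = fromℕ c
      M  = fromℕ m
      v  = 1 ÷ℕ m
      x  = s₁ ÷ℕ t
      y  = s₂ ÷ℕ t
      r₁ = t₁ ÷ℕ t
      ρ₁ = 1ℚ + C + M * x

open import Data.Nat using (ℕ; suc; _+_; _*_; _≥_; NonZero; >-nonZero)
open import Data.Product using (_×_; _,_)
open import Data.Rational using (_-_)
open import Relation.Binary.PropositionalEquality using (_≡_)
open Recurrences using (T-suc; sumξ-suc; T-positive)
open MeanVariance using (mean-from-recurrence; variance-from-recurrence)

theorem2p2 : (c m n : ℕ) → c ≥ 1 → m ≥ 1 → n ≥ 1 →
    (E c m n ≡ (T c m (suc n) ÷ℕ (m * T c m n)) - ((1 + c) ÷ℕ m))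
    × (V c m n ≡ ((T c m (suc (suc n)) ÷ℕ (m * m * T c m n))
                  - ((T c m (suc n) * T c m (suc n)) ÷ℕ (m * m * (T c m n * T c m n))))
                  - (1 ÷ℕ m))
theorem2p2 c m n _ m≥1 _ =
  mean-from-recurrence c m (T c m n) (T-suc c m n) ,
  variance-from-recurrence c m (T c m n) (T-suc c m n) (sumξ-suc c m n) (T-suc c m (suc n))
  where
  instance
    m≢0 : NonZero m
    m≢0 = >-nonZero m≥1
    T≢0 : NonZero (T c m n)
    T≢0 = >-nonZero (T-positive c m n)
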